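{- Let $t$ be a clean vsub-term. If $t{\downarrow}$ is a fireball, then $t$ is $\{\mathtt m,\mathtt e_\lambda\}$-normal (no $\to_{\mathtt m}$- and no $\to_{\mathtt e_\lambda}$-step applies to it) and its body is a fireball.
   Context: $\lambda$-terms: $t,u::= v\mid tu$, values $v::= x\mid \lambda x.t$; $t\{x\leftarrow u\}$ capture-avoiding substitution. Fireballs $f::=\lambda x.t\mid i$ and inert terms $i::= x f_1\dots f_n$ ($n\ge0$), defined by mutual induction. Value substitution calculus: vsub-terms $t,u::= v\mid tu\mid t[x\leftarrow u]$, vsub-values $v::=x\mid\lambda x.t$; $t[x\leftarrow u]$ binds $x$ in $t$. Evaluation contexts $E::=\langle\cdot\rangle\mid tE\mid Et\mid E[x\leftarrow u]\mid t[x\leftarrow E]$; substitution contexts $L::=\langle\cdot\rangle\mid L[x\leftarrow u]$. $\to_{\mathtt m}$, $\to_{\mathtt e_\lambda}$: closures under evaluation contexts of $L\langle\lambda x.t\rangle u\mapsto L\langle t[x\leftarrow u]\rangle$ and $t[x\leftarrow L\langle \lambda y.u\rangle]\mapsto L\langle t\{x\leftarrow\lambda y.u\}\rangle$ (bound variables of $L$ not free in $u$, resp. $t$). Unfolding: $x{\downarrow}=x$, $(tu){\downarrow}=t{\downarrow}u{\downarrow}$, $(\lambda x.t){\downarrow}=\lambda x.t{\downarrow}$, $(t[x\leftarrow u]){\downarrow}=t{\downarrow}\{x\leftarrow u{\downarrow}\}$. A vsub-term is clean if it is $u[x_1\leftarrow i_1]\dots[x_n\leftarrow i_n]$ ($n\ge0$)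 with $u$ a $\lambda$-term, called its body, and each $i_j$ an inert $\lambda$-term. -}

module Defs where

open import Data.Nat using (ℕ; zero; suc)
open import Data.Fin using (Fin; zero; suc)
open import Data.Product using (∃; _×_)
open import Relation.Nullary using (¬_)

-- Variables are de Bruijn indices; a term of type `Tm n` / `VT n` has
-- its free variables among n.  Capture avoidance is thus automatic.

data Tm (n : ℕ) : Set where
  var : Fin n → Tm n
  lam : Tm (suc n) → Tm n
  app : Tm n → Tm n → Tm n

liftR : ∀ {n m} → (Fin n → Fin m) → Fin (suc n) → Fin (suc m)
liftR ρ zero    = zero
liftR ρ (suc x) = suc (ρ x)

renTm : ∀ {n m} → (Fin n → Fin m) → Tm n → Tm m
renTm ρ (var x)   = var (ρ x)
renTm ρ (lam t)   = lam (renTm (liftR ρ) t)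
renTm ρ (app t u) = app (renTm ρ t) (renTm ρ u)

liftSTm : ∀ {n m} → (Fin n → Tm m) → Fin (suc n) → Tm (suc m)
liftSTm σ zero    = var zero
liftSTm σ (suc x) = renTm suc (σ x)

subTm : ∀ {n m} → (Fin n → Tm m) → Tm n → Tm m
subTm σ (var x)   = σ x
subTm σ (lam t)   = lam (subTm (liftSTm σ) t)
subTm σ (app t u) = app (subTm σ t) (subTm σ u)

single-Tm : ∀ {n} → Tm n → Fin (suc n) → Tm n
single-Tm u zero    = u
single-Tm u (suc x) = var x

_[0≔_]Tm : ∀ {n} → Tm (suc n) → Tm n → Tm n
t [0≔ u ]Tm = subTm (single-Tm u) t

mutual
  data Fireball {n : ℕ} : Tm n → Set where
    fb-lam   : (t : Tm (suc n)) → Fireball (lam t)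
    fb-inert : {i : Tm n} → Inert i → Fireball i

  data Inert {n : ℕ} : Tm n → Set where
    in-var : (x : Fin n) → Inert (var x)
    in-app : {i f : Tm n} → Inert i → Fireball f → Inert (app i f)

-- vsub-terms;  es t u  is  t[x ← u]  (x = variable 0 of t)

data VT (n : ℕ) : Set where
  var : Fin n → VT n
  lam : VT (suc n) → VT n
  app : VT n → VT n → VT n
  es  : VT (suc n) → VT n → VT n

renVT : ∀ {n m} → (Fin n → Fin m) → VT n → VT m
renVT ρ (var x)   = var (ρ x)
renVT ρ (lam t)   = lam (renVT (liftR ρ) t)
renVT ρ (app t u) = app (renVT ρ t) (renVT ρ u)
renVT ρ (es t u)  = es (renVT (liftR ρ) t) (renVT ρ u)

liftSVT : ∀ {n m} → (Fin n → VT m) → Fin (suc n) → VT (suc m)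
liftSVT σ zero    = var zero
liftSVT σ (suc x) = renVT suc (σ x)

subVT : ∀ {n m} → (Fin n → VT m) → VT n → VT m
subVT σ (var x)   = σ x
subVT σ (lam t)   = lam (subVT (liftSVT σ) t)
subVT σ (app t u) = app (subVT σ t) (subVT σ u)
subVT σ (es t u)  = es (subVT (liftSVT σ) t) (subVT σ u)

single-VT : ∀ {n} → VT n → Fin (suc n) → VT n
single-VT u zero    = u
single-VT u (suc x) = var x

_[0≔_]VT : ∀ {n} → VT (suc n) → VT n → VT n
t [0≔ u ]VT = subVT (single-VT u) t

⌜_⌝ : ∀ {n} → Tm n → VT n
⌜ var x ⌝   = var x
⌜ lam t ⌝   = lam ⌜ t ⌝
⌜ app t u ⌝ = app ⌜ t ⌝ ⌜ u ⌝

-- substitution contexts  L ::= ⟨·⟩ | L[x ← u]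
-- SCtx n m : plugging a term in scope m yields a term in scope n.

data SCtx (n : ℕ) : ℕ → Set where
  hole : SCtx n n
  _[≔_] : ∀ {m} → SCtx (suc n) m → VT n → SCtx n m

plug : ∀ {n m} → SCtx n m → VT m → VT n
plug hole       t = t
plug (L [≔ u ]) t = es (plug L t) u

-- renaming weakening a term past the binders of L
wkL : ∀ {n m} → SCtx n m → Fin n → Fin m
wkL hole       x = x
wkL (L [≔ u ]) x = wkL L (suc x)

-- L⟨λx.t⟩ u ↦ L⟨t[x ← u]⟩
data ↦m {n : ℕ} : VT n → VT n → Set where
  m-rule : ∀ {m} (L : SCtx n m) (t : VT (suc m)) (u : VT n) →
           ↦m (app (plug L (lam t)) u) (plug L (es t (renVT (wkL L) u)))

-- t[x ← L⟨λy.u⟩] ↦ L⟨t{x ← λy.u}⟩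
data ↦eλ {n : ℕ} : VT n → VT n → Set where
  e-rule : ∀ {m} (t : VT (suc n)) (L : SCtx n m) (u : VT (suc m)) →
           ↦eλ (es t (plug L (lam u)))
               (plug L ((renVT (liftR (wkL L)) t) [0≔ lam u ]VT))

data EvCl (R : ∀ {n} → VT n → VT n → Set) {n : ℕ} : VT n → VT n → Set where
  root : ∀ {t t'} → R t t' → EvCl R t t'
  appR : ∀ {t u u'} → EvCl R u u' → EvCl R (app t u) (app t u')
  appL : ∀ {t t' u} → EvCl R t t' → EvCl R (app t u) (app t' u)
  esL  : ∀ {t t' u} → EvCl R {suc n} t t' → EvCl R (es t u) (es t' u)
  esR  : ∀ {t u u'} → EvCl R u u' → EvCl R (es t u) (es t u')

_→m_ : ∀ {n} → VT n → VT n → Set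
_→m_ = EvCl ↦m

_→eλ_ : ∀ {n} → VT n → VT n → Set
_→eλ_ = EvCl ↦eλ

Normal : ∀ {n} → VT n → Set
Normal t = ¬ (∃ λ t' → t →m t') × ¬ (∃ λ t' → t →eλ t')

_↓ : ∀ {n} → VT n → Tm n
var x ↓   = var x
lam t ↓   = lam (t ↓)
app t u ↓ = app (t ↓) (u ↓)
es t u ↓  = (t ↓) [0≔ u ↓ ]Tm

-- clean terms: u[x₁ ← i₁]…[xₖ ← iₖ] with u a λ-term (the body) and
-- each iⱼ an inert λ-term.  Here: plug L ⌜ u ⌝ with L an inert-substitution context.

data InertSubs {n : ℕ} : ∀ {m} → SCtx n m → Set where
  hole : InertSubs hole
  _[≔_] : ∀ {m} {L : SCtx (suc n) m} {i : Tm n} →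
          InertSubs L → Inert i → InertSubs (L [≔ ⌜ i ⌝ ])

data Clean {n : ℕ} : VT n → Set where
  clean : ∀ {m} (L : SCtx n m) (u : Tm m) → InertSubs L → Clean (plug L ⌜ u ⌝)

bodyScope : ∀ {n} {t : VT n} → Clean t → ℕ
bodyScope (clean {m} L u _) = m

body : ∀ {n} {t : VT n} (c : Clean t) → Tm (bodyScope c)
body (clean L u _) = u

module Submission where

-- A clean term is  t = L⟨⌜u⌝⟩  where u is a λ-term (the body) and L is a
-- context of explicit substitutions [x ← i] of inert λ-terms i.
--
-- Its unfolding is  u{x₁ ← i₁ …}.  Being a fireball is reflected by
-- substitution: a variable is always inert, an abstraction always a
-- fireball, and an application that becomes inert after substitution was
-- already inert.  Peeling the substitutions of L one at a time shows u is
-- a fireball.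
--
-- Both →m and →eλ are closures EvCl R of a root relation R.
-- A generic argument (module NormalForms) shows that L⟨⌜u⌝⟩ admits no
-- EvCl R step when u is a fireball, provided R never fires on a variable,
-- an abstraction, an application with inert head, or a substitution of an
-- inert term.  Those four facts hold for ↦m and ↦eλ because a redex needs
-- an answer L⟨λy.s⟩ at the place where an inert term sits, and an inert
-- term is never an answer.

open import Defs
open import Data.Nat using (ℕ; suc)
open import Data.Fin using (Fin)
open import Data.Product using (_×_; _,_; ∃)
open import Data.Empty using (⊥)
open import Relation.Nullary using (¬_)
open import Relation.Binary.PropositionalEquality
  using (_≡_; refl; cong; cong₂; subst)

⌜⌝-↓ : ∀ {n} (u : Tm n) → ⌜ u ⌝ ↓ ≡ u
⌜⌝-↓ (var x)   = refl
⌜⌝-↓ (lam t)   = cong lam (⌜⌝-↓ t)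
⌜⌝-↓ (app t u) = cong₂ app (⌜⌝-↓ t) (⌜⌝-↓ u)

mutual
  fireball-unsubst : ∀ {n m} (σ : Fin n → Tm m) (u : Tm n) →
                     Fireball (subTm σ u) → Fireball u
  fireball-unsubst σ (var x)   _            = fb-inert (in-var x)
  fireball-unsubst σ (lam t)   _            = fb-lam t
  fireball-unsubst σ (app a b) (fb-inert i) = fb-inert (inert-unsubst σ (app a b) i)

  inert-unsubst : ∀ {n m} (σ : Fin n → Tm m) (u : Tm n) →
                  Inert (subTm σ u) → Inert u
  inert-unsubst σ (var x)   _              = in-var x
  inert-unsubst σ (lam t)   ()
  inert-unsubst σ (app a b) (in-app ia fb) =
    in-app (inert-unsubst σ a ia) (fireball-unsubst σ b fb)

body-fireball : ∀ {n m} (L : SCtx n m) (u : Tm m) →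
                Fireball (plug L ⌜ u ⌝ ↓) → Fireball u
body-fireball hole       u fb = subst Fireball (⌜⌝-↓ u) fb
body-fireball (L [≔ _ ]) u fb = body-fireball L u (fireball-unsubst _ _ fb)

answer-not-inert : ∀ {n m} (L : SCtx n m) {t : VT (suc m)} {i : Tm n} →
                   Inert i → plug L (lam t) ≡ ⌜ i ⌝ → ⊥
answer-not-inert hole       (in-var _)   ()
answer-not-inert hole       (in-app _ _) ()
answer-not-inert (_ [≔ _ ]) (in-var _)   ()
answer-not-inert (_ [≔ _ ]) (in-app _ _) ()

app-injectiveˡ : ∀ {n} {t t' u u' : VT n} → app t u ≡ app t' u' → t ≡ t'
app-injectiveˡ refl = refl

es-injectiveʳ : ∀ {n} {t t' : VT (suc n)} {u u' : VT n} → es t u ≡ es t' u' → u ≡ u'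
es-injectiveʳ refl = refl

module NormalForms
  (R : ∀ {n} → VT n → VT n → Set)
  (no-root-var : ∀ {n} {x : Fin n} {t'} → ¬ R (var x) t')
  (no-root-lam : ∀ {n} {t : VT (suc n)} {t'} → ¬ R (lam t) t')
  (no-root-inert-app : ∀ {n} {i u : Tm n} {t'} → Inert i → ¬ R (app ⌜ i ⌝ ⌜ u ⌝) t')
  (no-root-inert-es : ∀ {n} {s : VT (suc n)} {i : Tm n} {t'} → Inert i → ¬ R (es s ⌜ i ⌝) t')
  where

  mutual
    fireball-normal : ∀ {n} {u : Tm n} {t'} → Fireball u → ¬ EvCl R ⌜ u ⌝ t'
    fireball-normal (fb-lam t)   (root r) = no-root-lam r
    fireball-normal (fb-inert i) s        = inert-normal i s

    inert-normal : ∀ {n} {u : Tm n} {t'} → Inert u → ¬ EvCl R ⌜ u ⌝ t'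
    inert-normal (in-var x)   (root r) = no-root-var r
    inert-normal (in-app i f) (root r) = no-root-inert-app i r
    inert-normal (in-app i f) (appL s) = inert-normal i s
    inert-normal (in-app i f) (appR s) = fireball-normal f s

  clean-normal : ∀ {n m} {L : SCtx n m} {u : Tm m} {t'} →
                 InertSubs L → Fireball u → ¬ EvCl R (plug L ⌜ u ⌝) t'
  clean-normal hole         fb s        = fireball-normal fb s
  clean-normal (is [≔ ii ]) fb (root r) = no-root-inert-es ii r
  clean-normal (is [≔ ii ]) fb (esL s)  = clean-normal is fb s
  clean-normal (is [≔ ii ]) fb (esR s)  = inert-normal ii s

-- A multiplicative redex needs an answer in head position.
no-m-inert-app : ∀ {n} {i u : Tm n} {t'} → Inert i → ¬ ↦m (app ⌜ i ⌝ ⌜ u ⌝) t'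
no-m-inert-app {i = i} {u} ii r = redex-shape r refl
  where
  redex-shape : ∀ {t t'} → ↦m t t' → t ≡ app ⌜ i ⌝ ⌜ u ⌝ → ⊥
  redex-shape (m-rule L _ _) eq = answer-not-inert L ii (app-injectiveˡ eq)

-- An exponential redex needs an answer as the substituted term.
no-eλ-inert-es : ∀ {n} {s : VT (suc n)} {i : Tm n} {t'} → Inert i → ¬ ↦eλ (es s ⌜ i ⌝) t'
no-eλ-inert-es {s = s} {i} ii r = redex-shape r refl
  where
  redex-shape : ∀ {t t'} → ↦eλ t t' → t ≡ es s ⌜ i ⌝ → ⊥
  redex-shape (e-rule _ L _) eq = answer-not-inert L ii (es-injectiveʳ eq)

module Normal-m  = NormalForms ↦m  (λ ()) (λ ()) no-m-inert-app (λ _ ())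
module Normal-eλ = NormalForms ↦eλ (λ ()) (λ ()) (λ _ ()) no-eλ-inert-es

lemma4 : ∀ {n : ℕ} (t : VT n) (c : Clean t) →
         Fireball (t ↓) → Normal t × Fireball (body c)
lemma4 .(plug L ⌜ u ⌝) (clean L u inert-subs) unfolds-to-fireball =
  (no-m-step , no-eλ-step) , u-fireball
  where
  u-fireball : Fireball u
  u-fireball = body-fireball L u unfolds-to-fireball

  no-m-step : ¬ ∃ λ t' → plug L ⌜ u ⌝ →m t'
  no-m-step (_ , step) = Normal-m.clean-normal inert-subs u-fireball step

  no-eλ-step : ¬ ∃ λ t' → plug L ⌜ u ⌝ →eλ t'
  no-eλ-step (_ , step) = Normal-eλ.clean-normal inert-subs u-fireball step
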